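{- Let $p=\sum_{i=1}^n a_ix_i+a_0$ be a strongly admissible pattern of length $n$ and let $m$ be a $p$-admissible multiplicity. Then for every sequence of integers $s_1\geq\cdots\geq s_n\geq m$ it holds that $p(s_1,\dots,s_n)\geq s_1\geq\cdots\geq s_n$.
   Context: A (nonhomogeneous) pattern of length $n$ is $p(x_1,\dots,x_n)=\sum_{i=1}^n a_ix_i+a_0$ with $a_1,\dots,a_n$ nonzero integers and $a_0$ a nonzero integer. Put $\sigma_j=\sum_{i=1}^j a_i$. $p$ is admissible if $\sigma_j\geq 0$ for all $j\le n$ and either $a_0\geq 0$ or $\sigma_n>1$. A positive integer $m$ is a $p$-admissible multiplicity if $m\geq -a_0/(\sigma_n-1)$ when $\sigma_n>1$, no condition when $\sigma_n=1$, and $m\le a_0$ when $\sigma_n=0$. For admissible $p$ (so $a_1\geq 1$) define $p'=p-x_1$ if $a_1>1$, and $p'=p(0,x_1,\dots,x_{n-1})$ if $a_1=1$; let $\sigma'_j$ be the partial sums $\sum_{i\le j}a'_i$ of the coefficients $a'_i$ of the variables of $p'$. $p$ is strongly admissible if it is admissible and $\sigma'_j\geq 0$ for all possible $j$. -}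

module Defs where

open import Data.Integer using (ℤ; +_; _+_; _-_; _*_; -_; _≤_; _<_; 0ℤ; 1ℤ)
open import Data.Integer.Properties using (_≟_)
open import Data.List using (List; []; _∷_; zipWith; length; foldr)
open import Data.List.Relation.Unary.All using (All)
open import Data.List.Relation.Unary.Linked using (Linked)
open import Data.Product using (_×_)
open import Data.Sum using (_⊎_)
open import Relation.Nullary using (¬_; yes; no)
open import Relation.Binary.PropositionalEquality using (_≡_)

-- A pattern p = Σ a_i x_i + a₀ is given by its coefficient list
-- (a₁ ∷ … ∷ aₙ) and its constant term a₀.

sumℤ : List ℤ → ℤ
sumℤ = foldr _+_ 0ℤ

partialSums : List ℤ → List ℤ
partialSums = go 0ℤ
  where
  go : ℤ → List ℤ → List ℤ
  go acc []       = []
  go acc (a ∷ as) = (acc + a) ∷ go (acc + a) as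

evalPattern : List ℤ → ℤ → List ℤ → ℤ
evalPattern as a₀ s = sumℤ (zipWith _*_ as s) + a₀

IsPattern : List ℤ → ℤ → Set
IsPattern as a₀ = All (λ a → ¬ (a ≡ 0ℤ)) as × ¬ (a₀ ≡ 0ℤ)

Admissible : List ℤ → ℤ → Set
Admissible as a₀ = All (0ℤ ≤_) (partialSums as) × (0ℤ ≤ a₀ ⊎ 1ℤ < sumℤ as)

-- coefficients of the variables of p':
--   p' = p - x₁             if a₁ > 1   (coefficients a₁-1, a₂, …, aₙ)
--   p' = p(0,x₁,…,x_{n-1})  if a₁ = 1   (coefficients a₂, …, aₙ)
-- (the constant term of p' is a₀ in both cases)
derivCoeffs : List ℤ → List ℤ
derivCoeffs []       = []
derivCoeffs (a ∷ as) with a ≟ 1ℤ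
... | yes _ = as
... | no  _ = (a - 1ℤ) ∷ as

StronglyAdmissible : List ℤ → ℤ → Set
StronglyAdmissible as a₀ =
  Admissible as a₀ × All (0ℤ ≤_) (partialSums (derivCoeffs as))

-- m is a p-admissible multiplicity: m positive and
--   σₙ > 1  ⇒ m ≥ -a₀/(σₙ - 1)   (stated as m(σₙ-1) ≥ -a₀, same since σₙ-1 > 0)
--   σₙ = 0  ⇒ m ≤ a₀
--   σₙ = 1  ⇒ no condition
AdmissibleMultiplicity : List ℤ → ℤ → ℤ → Set
AdmissibleMultiplicity as a₀ m =
  0ℤ < m
  × (1ℤ < sumℤ as → - a₀ ≤ m * (sumℤ as - 1ℤ))
  × (sumℤ as ≡ 0ℤ → m ≤ a₀)

NonIncreasing : List ℤ → Set
NonIncreasing = Linked (λ x y → y ≤ x)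

-- Peeling one copy of x₁ off p gives  p(s) = s₁ + p'(t),  where p' is
-- the derived pattern and t = (s₁,…,sₙ) if a₁ > 1, t = (s₂,…,sₙ) if a₁ = 1.
-- The coefficients of p' have nonnegative partial sums σ'ⱼ (strong
-- admissibility), so by summation by parts (Abel),  Σ a'ᵢ tᵢ ≥ σ'_last · m
-- for every non-increasing t bounded below by m.  Since σ'_last = σₙ - 1, the
-- admissibility of p and m give (σₙ - 1)·m + a₀ ≥ 0, hence p'(t) ≥ 0.
module Submission where

open import Defs
open import Data.Integer using (ℤ; _≤_; _+_; _-_; _*_; -_; _<_; 0ℤ; 1ℤ)
open import Data.Integer.Base using (nonNegative)
open import Data.Integer.Properties
  using (_≟_; +-assoc; +-identityˡ; +-identityʳ; +-monoˡ-≤; +-mono-≤; *-monoˡ-≤-nonNeg;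
         *-monoʳ-≤-nonNeg; <⇒≤; ≤-refl; i≤i+j; i≤j⇒0≤j-i; module ≤-Reasoning)
open import Data.Integer.Tactic.RingSolver using (solve-∀)
open import Data.List using (List; []; _∷_; length; zipWith)
open import Data.List.Relation.Unary.All using (All; []; _∷_)
import Data.List.Relation.Unary.All as All
open import Data.List.Relation.Unary.Linked using (_∷_)
import Data.List.Relation.Unary.Linked as Linked
open import Data.Nat using (suc)
open import Data.Nat.Properties using (suc-injective)
open import Data.Product using (_×_; _,_)
open import Data.Sum using (_⊎_; inj₁; inj₂)
open import Relation.Nullary using (yes; no)
open import Relation.Binary.PropositionalEquality
  using (_≡_; refl; sym; trans; cong; subst)

-- Merging the first two coefficients a, b into a + b drops the first partial
-- sum and keeps all others; this lets induction on coefficient lists proceed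
-- with a growing head instead of an explicit accumulator.
partialSums-mergeHead : ∀ {P : ℤ → Set} a b bs →
  All P (partialSums (a ∷ b ∷ bs)) → All P (partialSums ((a + b) ∷ bs))
partialSums-mergeHead a b bs (_ ∷ later) rewrite sym (+-assoc 0ℤ a b) = later

partialSums-head : ∀ {P : ℤ → Set} b bs → All P (partialSums (b ∷ bs)) → P b
partialSums-head {P} b bs (first ∷ _) = subst P (+-identityˡ b) first

partialSums-last : ∀ {P : ℤ → Set} b cs → All P (partialSums (b ∷ cs)) → P (sumℤ (b ∷ cs))
partialSums-last {P} b [] (first ∷ []) =
  subst P (trans (+-identityˡ b) (sym (+-identityʳ b))) first
partialSums-last {P} b (c ∷ cs) sums =
  subst P (+-assoc b c (sumℤ cs))
    (partialSums-last (b + c) cs (partialSums-mergeHead b c cs sums))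

sumℤ-nonNeg : ∀ bs → All (0ℤ ≤_) (partialSums bs) → 0ℤ ≤ sumℤ bs
sumℤ-nonNeg []       _    = ≤-refl
sumℤ-nonNeg (b ∷ cs) sums = partialSums-last b cs sums

BoundedBelow : ℤ → List ℤ → Set
BoundedBelow m ts = NonIncreasing ts × All (m ≤_) ts

-- Each step trades
-- b·t for b·u₁ (using b ≥ 0 and t ≥ u₁) and merges b into c₁.
abel-head : ∀ b cs t us x → length us ≡ length cs → BoundedBelow x (t ∷ us) →
  All (0ℤ ≤_) (partialSums (b ∷ cs)) →
  sumℤ (b ∷ cs) * x ≤ sumℤ (zipWith _*_ (b ∷ cs) (t ∷ us))
abel-head b [] t [] x _ (_ , x≤t ∷ []) sums = begin
  (b + 0ℤ) * x ≡⟨ cong (_* x) (+-identityʳ b) ⟩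
  b * x        ≤⟨ *-monoˡ-≤-nonNeg b {{nonNegative b≥0}} x≤t ⟩
  b * t        ≡⟨ sym (+-identityʳ (b * t)) ⟩
  b * t + 0ℤ   ∎
  where
  open ≤-Reasoning
  b≥0 : 0ℤ ≤ b
  b≥0 = partialSums-head b [] sums
abel-head b (c ∷ cs) t (u ∷ us) x len (u≤t ∷ decreasing , _ ∷ bounded) sums = begin
  (b + (c + S)) * x    ≡⟨ cong (_* x) (sym (+-assoc b c S)) ⟩
  ((b + c) + S) * x    ≤⟨ abel-head (b + c) cs u us x (suc-injective len)
                            (decreasing , bounded) (partialSums-mergeHead b c cs sums) ⟩
  (b + c) * u + Z      ≡⟨ regroup b c u Z ⟩
  b * u + (c * u + Z)  ≤⟨ +-monoˡ-≤ (c * u + Z) (*-monoˡ-≤-nonNeg b {{nonNegative b≥0}} u≤t) ⟩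
  b * t + (c * u + Z)  ∎
  where
  open ≤-Reasoning
  S = sumℤ cs
  Z = sumℤ (zipWith _*_ cs us)
  b≥0 : 0ℤ ≤ b
  b≥0 = partialSums-head b (c ∷ cs) sums
  regroup : ∀ b c u Z → (b + c) * u + Z ≡ b * u + (c * u + Z)
  regroup = solve-∀

abel : ∀ bs ts x → length ts ≡ length bs → BoundedBelow x ts →
  All (0ℤ ≤_) (partialSums bs) → sumℤ bs * x ≤ sumℤ (zipWith _*_ bs ts)
abel []       []       x _   _       _    = ≤-refl
abel (b ∷ cs) (t ∷ us) x len bounded sums = abel-head b cs t us x (suc-injective len) bounded sums

derivArgs : List ℤ → List ℤ → List ℤ
derivArgs []       ss       = ss
derivArgs (a ∷ as) []       = []
derivArgs (a ∷ as) (s ∷ ss) with a ≟ 1ℤ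
... | yes _ = ss
... | no  _ = s ∷ ss

evalPattern-derivative : ∀ a as a₀ s ss →
  evalPattern (a ∷ as) a₀ (s ∷ ss)
    ≡ s + evalPattern (derivCoeffs (a ∷ as)) a₀ (derivArgs (a ∷ as) (s ∷ ss))
evalPattern-derivative a as a₀ s ss with a ≟ 1ℤ
... | yes refl = dropOne s (sumℤ (zipWith _*_ as ss)) a₀
  where
  dropOne : ∀ s Z a₀ → (1ℤ * s + Z) + a₀ ≡ s + (Z + a₀)
  dropOne = solve-∀
... | no  _    = lowerOne a s (sumℤ (zipWith _*_ as ss)) a₀
  where
  lowerOne : ∀ a s Z a₀ → (a * s + Z) + a₀ ≡ s + (((a - 1ℤ) * s + Z) + a₀)
  lowerOne = solve-∀

derivArgs-length : ∀ a as s ss → length ss ≡ length as →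
  length (derivArgs (a ∷ as) (s ∷ ss)) ≡ length (derivCoeffs (a ∷ as))
derivArgs-length a as s ss len with a ≟ 1ℤ
... | yes _ = len
... | no  _ = cong suc len

derivArgs-boundedBelow : ∀ m a as s ss → BoundedBelow m (s ∷ ss) →
  BoundedBelow m (derivArgs (a ∷ as) (s ∷ ss))
derivArgs-boundedBelow m a as s ss (decreasing , bounded) with a ≟ 1ℤ
... | yes _ = Linked.tail decreasing , All.tail bounded
... | no  _ = decreasing , bounded

sumℤ-derivCoeffs : ∀ a as → sumℤ (derivCoeffs (a ∷ as)) ≡ sumℤ (a ∷ as) - 1ℤ
sumℤ-derivCoeffs a as with a ≟ 1ℤ
... | yes refl = addSubOne (sumℤ as)
  where
  addSubOne : ∀ S → S ≡ (1ℤ + S) - 1ℤ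
  addSubOne = solve-∀
... | no  _    = shiftOne a (sumℤ as)
  where
  shiftOne : ∀ a S → (a - 1ℤ) + S ≡ (a + S) - 1ℤ
  shiftOne = solve-∀

-- The constant part of the Abel bound is nonnegative: if σ ≥ 1, m > 0 and
-- either a₀ ≥ 0 or (σ > 1 and m(σ - 1) ≥ -a₀), then (σ - 1)·m + a₀ ≥ 0.
-- This is exactly where admissibility of p and of m enter.
multiplicity-bound : ∀ σ a₀ m → 0ℤ ≤ σ - 1ℤ → 0ℤ < m →
  (0ℤ ≤ a₀ ⊎ 1ℤ < σ) → (1ℤ < σ → - a₀ ≤ m * (σ - 1ℤ)) →
  0ℤ ≤ (σ - 1ℤ) * m + a₀
multiplicity-bound σ a₀ m σ-1≥0 m>0 (inj₁ a₀≥0) _ =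
  +-mono-≤ (*-monoʳ-≤-nonNeg m {{nonNegative (<⇒≤ m>0)}} σ-1≥0) a₀≥0
multiplicity-bound σ a₀ m _ _ (inj₂ σ>1) m-large =
  subst (0ℤ ≤_) (reorder σ a₀ m) (i≤j⇒0≤j-i (m-large σ>1))
  where
  reorder : ∀ σ a₀ m → m * (σ - 1ℤ) - (- a₀) ≡ (σ - 1ℤ) * m + a₀
  reorder = solve-∀

mainTheorem15 : (a₁ : ℤ) (as : List ℤ) (a₀ : ℤ) (m : ℤ) →
    IsPattern (a₁ ∷ as) a₀ →
    StronglyAdmissible (a₁ ∷ as) a₀ →
    AdmissibleMultiplicity (a₁ ∷ as) a₀ m →
    (s₁ : ℤ) (ss : List ℤ) → length ss ≡ length as →
    NonIncreasing (s₁ ∷ ss) →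
    All (m ≤_) (s₁ ∷ ss) →
    s₁ ≤ evalPattern (a₁ ∷ as) a₀ (s₁ ∷ ss)
mainTheorem15 a₁ as a₀ m _ ((_ , constantCondition) , derivSums) (m>0 , m-large , _)
              s₁ ss len decreasing bounded = begin
  s₁                            ≤⟨ i≤i+j s₁ (evalPattern p′ a₀ t) {{nonNegative p′≥0}} ⟩
  s₁ + evalPattern p′ a₀ t      ≡⟨ sym (evalPattern-derivative a₁ as a₀ s₁ ss) ⟩
  evalPattern (a₁ ∷ as) a₀ (s₁ ∷ ss) ∎
  where
  open ≤-Reasoning
  p′ = derivCoeffs (a₁ ∷ as)
  t  = derivArgs (a₁ ∷ as) (s₁ ∷ ss)
  σ  = sumℤ (a₁ ∷ as)

  σ-1≥0 : 0ℤ ≤ σ - 1ℤ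
  σ-1≥0 = subst (0ℤ ≤_) (sumℤ-derivCoeffs a₁ as) (sumℤ-nonNeg p′ derivSums)

  p′≥0 : 0ℤ ≤ evalPattern p′ a₀ t
  p′≥0 = begin
    0ℤ                  ≤⟨ multiplicity-bound σ a₀ m σ-1≥0 m>0 constantCondition m-large ⟩
    (σ - 1ℤ) * m + a₀   ≡⟨ cong (λ σ′ → σ′ * m + a₀) (sym (sumℤ-derivCoeffs a₁ as)) ⟩
    sumℤ p′ * m + a₀    ≤⟨ +-monoˡ-≤ a₀ (abel p′ t m (derivArgs-length a₁ as s₁ ss len)
                             (derivArgs-boundedBelow m a₁ as s₁ ss (decreasing , bounded))
                             derivSums) ⟩
    evalPattern p′ a₀ t ∎
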